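{- Let $r\ge1$, $\lambda$ a partition with $r$ parts (some possibly zero), $N\ge\lambda_1+r-1$, $\mathbf{z}\in(\mathbb{C}^\times)^r$. The map that forgets colors (replacing every color by the spin $-$) is a bijection from the disjoint union over $w\in S_r$ of the sets of admissible states of the colored systems $\mathfrak{S}_{\mathbf{z},\lambda,w}$ onto the set of admissible states of the uncolored system $\mathfrak{S}_{\mathbf{z},\lambda}$, and it preserves Boltzmann weights. Consequently $$Z(\mathfrak{S}_{\mathbf{z},\lambda})=\sum_{w\in S_r}Z(\mathfrak{S}_{\mathbf{z},\lambda,w}).$$
   Context: Grid: $r$ rows labeled $1,\dots,r$ top to bottom, $N+1$ columns labeled $N,\dots,0$ left to right; each vertex has (left, top, right, bottom) edges. Uncolored system $\mathfrak{S}_{\mathbf{z},\lambda}$: spins $\pm$; top boundary edges in columns $\lambda_k+r-k$ ($k=1,\dots,r$) are $-$, other top boundary edges $+$; left and bottom boundary edges $+$; right boundary edges $-$. Vertex weights in row $k$ for (left, top, right, bottom): $(+,+,+,+)\mapsto1$, $(-,-,-,-)\mapsto z_k$, $(+,-,+,-)\mapsto0$, $(-,+,-,+)\mapsto z_k$, $(-,+,+,-)\mapsto z_k$, $(+,-,-,+)\mapsto1$, others $0$. Admissible state: all vertex weights nonzero. Colored system $\mathfrak{S}_{\mathbf{z},\lambda,w}$: colors $c_1>\cdots>c_r$, edges carry $+$ or a color; top boundary edge in column $\lambda_k+r-k$ carries $c_k$, other top edges $+$; left, bottom boundary edges $+$; right boundary edge of row $k$ carries $c_{w^{ -1}(k)}$.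 Vertex weights in row $k$: $(+,+,+,+)\mapsto1$; $(c,d,\max(c,d),\min(c,d))\mapsto z_k$ for colors $c,d$; $(c,+,c,+)\mapsto z_k$; $(c,+,+,c)\mapsto z_k$; $(+,c,c,+)\mapsto1$; all others $0$. Admissible: all vertex weights nonzero. Boltzmann weight of a state: product of vertex weights; $Z$ = sum over all states. -}

module Defs where

open import Level using (Level)
open import Algebra.Bundles using (CommutativeRing)
open import Data.Bool using (Bool; true; false; if_then_else_)
open import Data.Nat using (ℕ; zero; suc; _∸_; _≡ᵇ_)
open import Data.Nat using () renaming (_+_ to _+ℕ_)
open import Data.Fin using (Fin; zero; suc; toℕ; inject₁; fromℕ; _≟_; _≤?_)
open import Data.Fin.Properties using (all?)
open import Data.Maybe using (Maybe; just; nothing; maybe′)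
import Data.Maybe as Maybe
open import Data.Vec using (Vec; []; _∷_; lookup; tabulate; head; last; map; replicate; toList)
open import Data.Vec.Properties using (≡-dec)
open import Data.List using (List; [_]; concatMap; cartesianProduct; filter; allFin; foldr)
import Data.List as L
open import Data.Product using (_×_; _,_; proj₁; proj₂)
open import Relation.Nullary using (Dec; yes; no; does; ¬_)
open import Relation.Nullary.Decidable using (_×-dec_)
open import Relation.Binary.PropositionalEquality using (_≡_; refl)
open import Relation.Binary.Definitions using (DecidableEquality)
import Data.List.Relation.Unary.Unique.DecPropositional as UDP

data USpin : Set where
  ⊕ ⊖ : USpin

-- Colored spins for r colors: ✚ is +, col i is the color c_{i+1}
-- (0-indexed i : Fin r).  Colors are ordered c_1 > c_2 > ... > c_r,
-- i.e. col i > col j  iff  i < j (as elements of Fin r).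

data CSpin (r : ℕ) : Set where
  ✚   : CSpin r
  col : Fin r → CSpin r

_≟U_ : DecidableEquality USpin
⊕ ≟U ⊕ = yes refl
⊕ ≟U ⊖ = no λ ()
⊖ ≟U ⊕ = no λ ()
⊖ ≟U ⊖ = yes refl

_≟C_ : ∀ {r} → DecidableEquality (CSpin r)
✚ ≟C ✚ = yes refl
✚ ≟C col _ = no λ ()
col _ ≟C ✚ = no λ ()
col i ≟C col j with i ≟ j
... | yes refl = yes refl
... | no i≢j = no λ { refl → i≢j refl }

forgetSpin : ∀ {r} → CSpin r → USpin
forgetSpin ✚       = ⊕
forgetSpin (col _) = ⊖

-- index of max(c_i, c_j) and of min(c_i, c_j)  (c decreasing in the index)
colMax colMin : ∀ {r} → Fin r → Fin r → Fin r
colMax i j = if does (i ≤? j) then i else j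
colMin i j = if does (i ≤? j) then j else i

-- Grid configurations.
-- Rows k : Fin r (row k+1 of the paper, top to bottom).
-- Columns c : Fin (suc N), indexed by their label toℕ c ∈ {0..N}
-- (label N leftmost, label 0 rightmost).
--
-- Horizontal edges: H : Vec (Vec A (N+2)) r ; entry j of row k is the
--   edge to the right of column j (j ≤ N) and to the left of column j-1;
--   j = N+1 is the left boundary edge, j = 0 the right boundary edge.
-- Vertical edges: V : Vec (Vec A (N+1)) (r+1) ; entry i of column c is the
--   edge above row i (i < r) / below row i-1; i = 0 top boundary, i = r
--   bottom boundary.

Config : Set → ℕ → ℕ → Set
Config A r N = Vec (Vec A (suc (suc N))) r × Vec (Vec A (suc N)) (suc r)

forget : ∀ {r N} → Config (CSpin r) r N → Config USpin r N
forget (H , V) = map (map forgetSpin) H , map (map forgetSpin) V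

leftE rightE : ∀ {A r N} → Config A r N → Fin r → Fin (suc N) → A
leftE  (H , V) k c = lookup (lookup H k) (suc c)
rightE (H , V) k c = lookup (lookup H k) (inject₁ c)

topE botE : ∀ {A r N} → Config A r N → Fin r → Fin (suc N) → A
topE (H , V) k c = lookup (lookup V (inject₁ k)) c
botE (H , V) k c = lookup (lookup V (suc k)) c

Nonincreasing : ∀ {r} → Vec ℕ r → Set
Nonincreasing {r} lam = ∀ (i j : Fin r) → i Data.Fin.≤ j → lookup lam j Data.Nat.≤ lookup lam i

-- the k with  λ_k + r - k = c  (0-indexed: lookup lam i + (r - 1 - i) = c), if any
seek : ∀ {r} → (Fin r → ℕ) → ℕ → Maybe (Fin r)
seek {zero}  f c = nothing
seek {suc r} f c = if f zero ≡ᵇ c then just zero else Maybe.map suc (seek (λ i → f (suc i)) c)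

partCol : ∀ {r} → Vec ℕ r → ℕ → Maybe (Fin r)
partCol {r} lam c = seek (λ i → lookup lam i +ℕ (r ∸ suc (toℕ i))) c

topU : ∀ {r} N → Vec ℕ r → Vec USpin (suc N)
topU N lam = tabulate λ c → maybe′ (λ _ → ⊖) ⊕ (partCol lam (toℕ c))

topC : ∀ {r} N → Vec ℕ r → Vec (CSpin r) (suc N)
topC N lam = tabulate λ c → maybe′ col ✚ (partCol lam (toℕ c))

BdryU : ∀ {r N} → Vec ℕ r → Config USpin r N → Set
BdryU {r} {N} lam (H , V) =
  (head V ≡ topU N lam) × (map last H ≡ replicate r ⊕) ×
  (last V ≡ replicate (suc N) ⊕) × (map head H ≡ replicate r ⊖)

-- w : Vec (Fin r) r represents the permutation i ↦ w(i); the right boundary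
-- edge of row k carries c_{w⁻¹(k)}, i.e. row w(i) carries c_i for every i.
BdryC : ∀ {r N} → Vec ℕ r → Vec (Fin r) r → Config (CSpin r) r N → Set
BdryC {r} {N} lam w (H , V) =
  (head V ≡ topC N lam) × (map last H ≡ replicate r ✚) ×
  (last V ≡ replicate (suc N) ✚) × (∀ i → head (lookup H (lookup w i)) ≡ col i)

bdryU? : ∀ {r N} (lam : Vec ℕ r) (s : Config USpin r N) → Dec (BdryU lam s)
bdryU? lam (H , V) =
  ≡-dec _≟U_ _ _ ×-dec ≡-dec _≟U_ _ _ ×-dec ≡-dec _≟U_ _ _ ×-dec ≡-dec _≟U_ _ _

bdryC? : ∀ {r N} (lam : Vec ℕ r) (w : Vec (Fin r) r) (s : Config (CSpin r) r N) → Dec (BdryC lam w s)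
bdryC? lam w (H , V) =
  ≡-dec _≟C_ _ _ ×-dec ≡-dec _≟C_ _ _ ×-dec ≡-dec _≟C_ _ _ ×-dec
  all? (λ i → head (lookup H (lookup w i)) ≟C col i)

vecs : ∀ {A : Set} → List A → (n : ℕ) → List (Vec A n)
vecs xs zero    = [ [] ]
vecs xs (suc n) = concatMap (λ x → L.map (x ∷_) (vecs xs n)) xs

allUSpin : List USpin
allUSpin = ⊕ L.∷ ⊖ L.∷ L.[]

allCSpin : ∀ r → List (CSpin r)
allCSpin r = ✚ L.∷ L.map col (allFin r)

allConfigs : ∀ {A : Set} → List A → ∀ r N → List (Config A r N)
allConfigs xs r N = cartesianProduct (vecs (vecs xs (suc (suc N))) r) (vecs (vecs xs (suc N)) (suc r))

IsPerm : ∀ {r} → Vec (Fin r) r → Set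
IsPerm {r} w = UDP.Unique (_≟_ {r}) (toList w)

isPerm? : ∀ {r} (w : Vec (Fin r) r) → Dec (IsPerm w)
isPerm? w = UDP.unique? _≟_ (toList w)

allPerms : ∀ r → List (Vec (Fin r) r)
allPerms r = filter isPerm? (vecs (allFin r) r)

-- Weights, valued in a commutative ring R (ℂ in the paper).

module Weights {c ℓ : Level} (R : CommutativeRing c ℓ) where
  open CommutativeRing R using (Carrier; _+_; _*_; 0#; 1#; _≈_)

  -- vertex weight in a row with spectral parameter x, (left, top, right, bottom)
  wtU : Carrier → USpin → USpin → USpin → USpin → Carrier
  wtU x ⊕ ⊕ ⊕ ⊕ = 1#
  wtU x ⊖ ⊖ ⊖ ⊖ = x
  wtU x ⊕ ⊖ ⊕ ⊖ = 0#
  wtU x ⊖ ⊕ ⊖ ⊕ = x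
  wtU x ⊖ ⊕ ⊕ ⊖ = x
  wtU x ⊕ ⊖ ⊖ ⊕ = 1#
  wtU x _ _ _ _ = 0#

  wtC : ∀ {r} → Carrier → CSpin r → CSpin r → CSpin r → CSpin r → Carrier
  wtC x ✚ ✚ ✚ ✚ = 1#
  wtC x (col a) (col b) (col m) (col n) =
    if does (m ≟ colMax a b) then (if does (n ≟ colMin a b) then x else 0#) else 0#
  wtC x (col a) ✚ (col m) ✚ = if does (a ≟ m) then x else 0#
  wtC x (col a) ✚ ✚ (col n) = if does (a ≟ n) then x else 0#
  wtC x ✚ (col b) (col m) ✚ = if does (b ≟ m) then 1# else 0#
  wtC x _ _ _ _ = 0#

  prod : List Carrier → Carrier
  prod = foldr _*_ 1#

  sum : List Carrier → Carrier
  sum = foldr _+_ 0#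

  vertexWtU : ∀ {r N} → (Fin r → Carrier) → Config USpin r N → Fin r → Fin (suc N) → Carrier
  vertexWtU z s k c = wtU (z k) (leftE s k c) (topE s k c) (rightE s k c) (botE s k c)

  vertexWtC : ∀ {r N} → (Fin r → Carrier) → Config (CSpin r) r N → Fin r → Fin (suc N) → Carrier
  vertexWtC z s k c = wtC (z k) (leftE s k c) (topE s k c) (rightE s k c) (botE s k c)

  boltzU : ∀ {r N} → (Fin r → Carrier) → Config USpin r N → Carrier
  boltzU {r} {N} z s = prod (L.map (λ k → prod (L.map (vertexWtU z s k) (allFin (suc N)))) (allFin r))

  boltzC : ∀ {r N} → (Fin r → Carrier) → Config (CSpin r) r N → Carrier
  boltzC {r} {N} z s = prod (L.map (λ k → prod (L.map (vertexWtC z s k) (allFin (suc N)))) (allFin r))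

  AdmU : ∀ {r N} → (Fin r → Carrier) → Vec ℕ r → Config USpin r N → Set ℓ
  AdmU z lam s = BdryU lam s × (∀ k c → ¬ (vertexWtU z s k c ≈ 0#))

  AdmC : ∀ {r N} → (Fin r → Carrier) → Vec ℕ r → Vec (Fin r) r → Config (CSpin r) r N → Set ℓ
  AdmC z lam w s = BdryC lam w s × (∀ k c → ¬ (vertexWtC z s k c ≈ 0#))

  ZU : ∀ r N → (Fin r → Carrier) → Vec ℕ r → Carrier
  ZU r N z lam = sum (L.map (boltzU z) (filter (bdryU? lam) (allConfigs allUSpin r N)))

  ZC : ∀ r N → (Fin r → Carrier) → Vec ℕ r → Vec (Fin r) r → Carrier
  ZC r N z lam w = sum (L.map (boltzC z) (filter (bdryC? lam w) (allConfigs (allCSpin r) r N)))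

-- A vertex of nonzero weight merely permutes the spins on its incoming (left, top) edges onto its
-- outgoing (right, bottom) edges, and which permutation occurs is read off from the uncoloured spins:
-- a colour goes wherever the outgoing spin is -, and two colours meeting leave as max to the right
-- and min downwards.  So an admissible coloured state is recovered from its uncoloured image by
-- colouring row by row, left to right, starting from the colours on the top boundary; conversely this
-- colours every admissible uncoloured state, with the same weight at every vertex.  Colours are
-- never destroyed, and none can leave through the bottom or left boundary (all +), so each colour of
-- the top boundary leaves through a row on the right, which determines the permutation w.  Summing
-- along this bijection between the supports of the two sides gives the identity of partition functions.

module Submission where

open import Defs
open import Level using (Level)
open import Algebra.Bundles using (CommutativeRing)
open import Data.Bool using (T; true; false; if_then_else_)
open import Data.Fin using (Fin; zero; suc; toℕ; fromℕ<; inject₁; _≟_; _≤?_; punchOut)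
open import Data.Fin.Properties using (any?; all?; ¬∀⟶∃¬; injective⇒≤; punchOut-injective; suc-injective; toℕ<n; toℕ-fromℕ<)
open import Data.List using (List; []; _∷_; _++_; map; concatMap; cartesianProduct; filter; allFin)
import Data.List.Properties as ListP
open import Data.List.Membership.Propositional using () renaming (_∈_ to _∈ₗ_)
open import Data.List.Membership.Propositional.Properties using (∈-allFin)
import Data.List.Relation.Unary.Any as ListAny
open import Data.List.Relation.Unary.AllPairs using (_∷_; [])
import Data.List.Relation.Unary.Unique.DecPropositional as ListUnique
open import Data.Maybe using (Maybe; just; nothing; maybe′)
import Data.Maybe as Maybe
open import Data.Nat using (ℕ; suc; _+_; _≤_; _<_; _∸_; _≡ᵇ_; z≤n; s≤s)
import Data.Nat as ℕ
open import Data.Nat.Properties using (1+n≰n; ≡ᵇ⇒≡; ≡⇒≡ᵇ; <-irrefl; <⇒≤; ≤-pred; ≤-trans; +-mono-≤; +-mono-≤-<; ∸-monoʳ-<; m∸n≤m)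
open import Data.Product using (_×_; _,_; proj₁; proj₂; Σ-syntax; ∃-syntax)
open import Data.Product.Properties using (,-injectiveˡ; ,-injectiveʳ; ≡-dec)
open import Data.Sum using (_⊎_; inj₁; inj₂; [_,_]′)
import Data.Sum as Sum
open import Data.Vec using (Vec; []; _∷_; head; last; lookup; replicate; tabulate; toList)
import Data.Vec as Vec
open import Data.Vec.Properties using (∷-injective; ∷-injectiveˡ; ∷-injectiveʳ; lookup-map; map-∘; map-cong; map-replicate; lookup∘tabulate; tabulate∘lookup; tabulate-cong; tabulate-∘; lookup-replicate)
import Data.Vec.Properties as VecP
open import Data.Vec.Membership.Propositional using (_∈_)
open import Data.Vec.Membership.Propositional.Properties using (∈-tabulate⁺)
open import Data.Vec.Relation.Unary.Any using (here; there; index)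
open import Data.Vec.Relation.Unary.Any.Properties using (lookup-index)
open import Data.Vec.Relation.Unary.AllPairs using (_∷_; [])
import Data.Vec.Relation.Unary.All.Properties as VecAll
import Data.Vec.Relation.Unary.Unique.Propositional as VecUnique
import Data.Vec.Relation.Unary.Unique.Propositional.Properties as VecUnique
open import Function using (_∘_; id)
open import Function.Definitions using (Injective)
open import Relation.Binary.Definitions using (DecidableEquality)
open import Relation.Binary.PropositionalEquality using (_≡_; _≢_; refl; sym; trans; cong; cong₂; subst; module ≡-Reasoning)
open import Relation.Nullary using (¬_; ¬?; yes; no; does; contradiction)
open import Relation.Nullary.Decidable using (Dec; map′; _×-dec_; decidable-stable)
open import Relation.Unary using (Pred; Decidable)
import Relation.Binary.Reasoning.Setoid as SetoidReasoning

variable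
  A B C : Set
  n r : ℕ

-- Vectors and permutations

head-map : (g : A → B) (v : Vec A (suc n)) → head (Vec.map g v) ≡ g (head v)
head-map g (x ∷ v) = refl

last-map : (g : A → B) (v : Vec A (suc n)) → last (Vec.map g v) ≡ g (last v)
last-map g (x ∷ []) = refl
last-map g (x ∷ y ∷ v) = last-map g (y ∷ v)

map-head-map : ∀ {m} (g : A → B) (M : Vec (Vec A (suc n)) m) → Vec.map head (Vec.map (Vec.map g) M) ≡ Vec.map g (Vec.map head M)
map-head-map g M = trans (sym (map-∘ head (Vec.map g) M)) (trans (map-cong (head-map g) M) (map-∘ g head M))

map-last-map : ∀ {m} (g : A → B) (M : Vec (Vec A (suc n)) m) → Vec.map last (Vec.map (Vec.map g) M) ≡ Vec.map g (Vec.map last M)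
map-last-map g M = trans (sym (map-∘ last (Vec.map g) M)) (trans (map-cong (last-map g) M) (map-∘ g last M))

lookup-map² : ∀ {m} (g : A → B) (M : Vec (Vec A n) m) k j →
  lookup (lookup (Vec.map (Vec.map g) M) k) j ≡ g (lookup (lookup M k) j)
lookup-map² g M k j = trans (cong (λ v → lookup v j) (lookup-map k (Vec.map g) M)) (lookup-map j g (lookup M k))

lookup-ext : {u v : Vec A n} → (∀ i → lookup u i ≡ lookup v i) → u ≡ v
lookup-ext {u = u} {v} u≗v = trans (sym (tabulate∘lookup u)) (trans (tabulate-cong u≗v) (tabulate∘lookup v))

≡-replicate : {v : Vec A n} {x : A} → (∀ i → lookup v i ≡ x) → v ≡ replicate n x
≡-replicate e = lookup-ext (λ i → trans (e i) (sym (lookup-replicate i _)))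

toList-unique⁻ : ∀ {m} {w : Vec (Fin n) m} → ListUnique.Unique _≟_ (toList w) → VecUnique.Unique w
toList-unique⁻ {w = []} [] = []
toList-unique⁻ {w = i ∷ w} (i∉w ∷ w-unique) = VecAll.toList⁻ i∉w ∷ toList-unique⁻ w-unique

toList-unique⁺ : ∀ {m} {w : Vec (Fin n) m} → VecUnique.Unique w → ListUnique.Unique _≟_ (toList w)
toList-unique⁺ [] = []
toList-unique⁺ (i∉w ∷ w-unique) = VecAll.toList⁺ i∉w ∷ toList-unique⁺ w-unique

injective⇒surjective : {g : Fin n → Fin n} → Injective _≡_ _≡_ g → ∀ k → ∃[ i ] g i ≡ k
injective⇒surjective {ℕ.zero} _ ()
injective⇒surjective {suc n} {g} g-injective k with any? (λ i → g i ≟ k)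
... | yes hit = hit
... | no miss = contradiction (injective⇒≤ punchOut-g-injective) 1+n≰n
  where
  k≢g : ∀ i → k ≢ g i
  k≢g i e = miss (i , sym e)
  punchOut-g-injective : Injective _≡_ _≡_ (λ i → punchOut (k≢g i))
  punchOut-g-injective e = g-injective (punchOut-injective (k≢g _) (k≢g _) e)

isPerm-surjective : {w : Vec (Fin n) n} → IsPerm w → ∀ k → ∃[ i ] lookup w i ≡ k
isPerm-surjective w-perm = injective⇒surjective (VecUnique.lookup-injective (toList-unique⁻ w-perm) _ _)

tabulate-isPerm : {g : Fin n → Fin n} → Injective _≡_ _≡_ g → IsPerm (tabulate g)
tabulate-isPerm g-injective = toList-unique⁺ (VecUnique.tabulate⁺ g-injective)

labels-determine-perm : (ρ κ : Fin n → A) → Injective _≡_ _≡_ κ → (w₁ w₂ : Vec (Fin n) n) → IsPerm w₂ →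
  (∀ i → ρ (lookup w₁ i) ≡ κ i) → (∀ i → ρ (lookup w₂ i) ≡ κ i) → w₁ ≡ w₂
labels-determine-perm ρ κ κ-injective w₁ w₂ w₂-perm ρw₁ ρw₂ = lookup-ext same
  where
  same : ∀ i → lookup w₁ i ≡ lookup w₂ i
  same i with isPerm-surjective w₂-perm (lookup w₁ i)
  ... | j , w₂j≡w₁i = trans (sym w₂j≡w₁i) (cong (lookup w₂) j≡i)
    where
    j≡i = κ-injective (trans (sym (ρw₂ j)) (trans (cong ρ w₂j≡w₁i) (ρw₁ i)))

-- Colour propagation

col-injective : Injective _≡_ _≡_ (col {r})
col-injective refl = refl

forgetSpin⁻¹-⊕ : (x : CSpin r) → forgetSpin x ≡ ⊕ → x ≡ ✚
forgetSpin⁻¹-⊕ ✚ _ = refl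

map-forgetSpin⁻¹-⊕ : (v : Vec (CSpin r) n) → Vec.map forgetSpin v ≡ replicate n ⊕ → v ≡ replicate n ✚
map-forgetSpin⁻¹-⊕ [] _ = refl
map-forgetSpin⁻¹-⊕ (x ∷ v) e = cong₂ _∷_ (forgetSpin⁻¹-⊕ x (cong head e)) (map-forgetSpin⁻¹-⊕ v (cong Vec.tail e))

col∉replicate-✚ : {i : Fin r} → ¬ col i ∈ replicate n ✚
col∉replicate-✚ {n = suc n} (there p) = col∉replicate-✚ p

colMax-colMin : (i j : Fin r) → (colMax i j ≡ i × colMin i j ≡ j) ⊎ (colMax i j ≡ j × colMin i j ≡ i)
colMax-colMin i j with does (i ≤? j)
... | true = inj₁ (refl , refl)
... | false = inj₂ (refl , refl)

-- The colours on the right and bottom edges of a vertex, given the colours on its left and top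
-- edges and the uncoloured spins on its right and bottom edges: the only choice of nonzero weight.
propagate : CSpin r → CSpin r → USpin → USpin → CSpin r × CSpin r
propagate ✚ ✚ _ _ = ✚ , ✚
propagate ✚ (col j) _ _ = col j , ✚
propagate (col i) (col j) _ _ = col (colMax i j) , col (colMin i j)
propagate (col i) ✚ ⊖ _ = col i , ✚
propagate (col i) ✚ ⊕ _ = ✚ , col i

propagate-permutes : (a b : CSpin r) (u v : USpin) → propagate a b u v ≡ (a , b) ⊎ propagate a b u v ≡ (b , a)
propagate-permutes ✚ ✚ _ _ = inj₁ refl
propagate-permutes ✚ (col j) _ _ = inj₂ refl
propagate-permutes (col i) ✚ ⊖ _ = inj₁ refl
propagate-permutes (col i) ✚ ⊕ _ = inj₂ refl
propagate-permutes (col i) (col j) _ _ with colMax-colMin i j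
... | inj₁ (max≡i , min≡j) = inj₁ (cong₂ (λ p q → col p , col q) max≡i min≡j)
... | inj₂ (max≡j , min≡i) = inj₂ (cong₂ (λ p q → col p , col q) max≡j min≡i)

propagate-flow : {x : CSpin r} (a b : CSpin r) (u v : USpin) → x ≡ a ⊎ x ≡ b →
  x ≡ proj₁ (propagate a b u v) ⊎ x ≡ proj₂ (propagate a b u v)
propagate-flow a b u v x∈ with propagate a b u v | propagate-permutes a b u v
... | _ | inj₁ refl = x∈
... | _ | inj₂ refl = Sum.swap x∈

-- Rows are coloured from the left: the horizontal edges of a row are indexed from the right
-- boundary (index 0), so a partial row is extended by attaching a vertex on its right.
attachVertex : CSpin r → USpin → USpin → Vec (CSpin r) (suc n) × Vec (CSpin r) n →
  Vec (CSpin r) (suc (suc n)) × Vec (CSpin r) (suc n)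
attachVertex t u v (hs , bs) = proj₁ out ∷ hs , proj₂ out ∷ bs
  where out = propagate (head hs) t u v

liftRow : CSpin r → Vec USpin (suc n) → Vec (CSpin r) n → Vec USpin n → Vec (CSpin r) (suc n) × Vec (CSpin r) n
liftRow a _ [] [] = a ∷ [] , []
liftRow a (u ∷ hs) (t ∷ ts) (v ∷ bs) = attachVertex t u v (liftRow a hs ts bs)

liftRows : ∀ {m N} → Vec (CSpin r) (suc N) → Config USpin m N →
  Vec (Vec (CSpin r) (suc (suc N))) m × Vec (Vec (CSpin r) (suc N)) m
liftRows T ([] , _) = [] , []
liftRows T (h ∷ H , _ ∷ b ∷ V) = proj₁ row ∷ proj₁ rest , proj₂ row ∷ proj₂ rest
  where
  row = liftRow ✚ h T b
  rest = liftRows (proj₂ row) (H , b ∷ V)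

-- The uncoloured top boundary of t is ignored: T takes its place.
liftGrid : ∀ {m N} → Vec (CSpin r) (suc N) → Config USpin m N → Config (CSpin r) m N
liftGrid T t = proj₁ (liftRows T t) , T ∷ proj₂ (liftRows T t)

attachVertex-flow : {x : CSpin r} (t : CSpin r) (u v : USpin) (hs : Vec (CSpin r) (suc n)) (bs : Vec (CSpin r) n) →
  x ≡ t ⊎ x ∈ head hs ∷ bs → x ∈ head (proj₁ (attachVertex t u v (hs , bs))) ∷ proj₂ (attachVertex t u v (hs , bs))
attachVertex-flow t u v hs bs (inj₁ x≡t) = [ here , there ∘ here ]′ (propagate-flow (head hs) t u v (inj₂ x≡t))
attachVertex-flow t u v hs bs (inj₂ (here x≡l)) = [ here , there ∘ here ]′ (propagate-flow (head hs) t u v (inj₁ x≡l))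
attachVertex-flow t u v hs bs (inj₂ (there x∈bs)) = there (there x∈bs)

liftRow-flow : {x : CSpin r} (a : CSpin r) (hs : Vec USpin (suc n)) (ts : Vec (CSpin r) n) (bs : Vec USpin n) →
  x ∈ a ∷ ts → x ∈ head (proj₁ (liftRow a hs ts bs)) ∷ proj₂ (liftRow a hs ts bs)
liftRow-flow a _ [] [] x∈ = x∈
liftRow-flow a (u ∷ hs) (t ∷ ts) (v ∷ bs) x∈ = attachVertex-flow t u v hs′ bs′ (rest x∈)
  where
  hs′ = proj₁ (liftRow a hs ts bs)
  bs′ = proj₂ (liftRow a hs ts bs)
  rest : _ ∈ a ∷ t ∷ ts → _ ≡ t ⊎ _ ∈ head hs′ ∷ bs′
  rest (here x≡a) = inj₂ (liftRow-flow a hs ts bs (here x≡a))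
  rest (there (here x≡t)) = inj₁ x≡t
  rest (there (there x∈ts)) = inj₂ (liftRow-flow a hs ts bs (there x∈ts))

liftGrid-flow : ∀ {m N} {x : CSpin r} (T : Vec (CSpin r) (suc N)) (t : Config USpin m N) → x ∈ ✚ ∷ T →
  x ∈ Vec.map head (proj₁ (liftGrid T t)) ⊎ x ∈ ✚ ∷ last (proj₂ (liftGrid T t))
liftGrid-flow T ([] , _) x∈ = inj₂ x∈
liftGrid-flow T (h ∷ H , _ ∷ b ∷ V) x∈ with liftRow-flow ✚ h T b x∈
... | here x≡h₀ = inj₁ (here x≡h₀)
... | there x∈b′ = Sum.map₁ there (liftGrid-flow _ (H , b ∷ V) (there x∈b′))

colour-exits-right : ∀ {m N} (T : Vec (CSpin r) (suc N)) (t : Config USpin m N) →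
  last (proj₂ (liftGrid T t)) ≡ replicate (suc N) ✚ →
  ∀ {i} → col i ∈ T → ∃[ k ] head (lookup (proj₁ (liftGrid T t)) k) ≡ col i
colour-exits-right T t bottom i∈T with liftGrid-flow T t (there i∈T)
... | inj₁ i∈right =
  index i∈right , sym (trans (lookup-index i∈right) (lookup-map (index i∈right) head (proj₁ (liftGrid T t))))
... | inj₂ i∈bottom = contradiction (subst (λ b → col _ ∈ ✚ ∷ b) bottom i∈bottom) col∉replicate-✚

-- The top boundary

seek-hit : (g : Fin n → ℕ) (i : Fin n) → (∀ j → toℕ j < toℕ i → g j ≢ g i) → seek g (g i) ≡ just i
seek-hit g zero _ with g zero ≡ᵇ g zero in eq
... | true = refl
... | false = contradiction (subst T eq (≡⇒≡ᵇ (g zero) (g zero) refl)) λ ()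
seek-hit g (suc i) earlier with g zero ≡ᵇ g (suc i) in eq
... | true = contradiction (≡ᵇ⇒≡ (g zero) (g (suc i)) (subst T (sym eq) _)) (earlier zero (s≤s z≤n))
... | false = cong (Maybe.map suc) (seek-hit (g ∘ suc) i (λ j j<i → earlier (suc j) (s≤s j<i)))

topColumn : ∀ N → Vec ℕ r → Fin (suc N) → CSpin r
topColumn N lam c = maybe′ col ✚ (partCol lam (toℕ c))

topC-forget : ∀ N (lam : Vec ℕ r) → Vec.map forgetSpin (topC N lam) ≡ topU N lam
topC-forget N lam =
  trans (sym (tabulate-∘ forgetSpin (topColumn N lam))) (tabulate-cong (λ c → forget-maybe (partCol lam (toℕ c))))
  where
  forget-maybe : (p : Maybe (Fin r)) → forgetSpin (maybe′ col ✚ p) ≡ maybe′ (λ _ → ⊖) ⊕ p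
  forget-maybe (just _) = refl
  forget-maybe nothing = refl

-- Part k of λ (0-indexed, r = m + 1 parts) sits in column λ_k + (m - k); these columns strictly
-- decrease in k and are at most λ_0 + m ≤ N.
topC-contains : ∀ {m N} (lam : Vec ℕ (suc m)) → Nonincreasing lam → head lam + m ≤ N → ∀ i → col i ∈ topC N lam
topC-contains {m} {N} lam@(_ ∷ _) ni bd i = subst (_∈ topC N lam) at-column (∈-tabulate⁺ (topColumn N lam) (fromℕ< column<))
  where
  column : Fin (suc m) → ℕ
  column j = lookup lam j + (m ∸ toℕ j)
  column< : column i < suc N
  column< = s≤s (≤-trans (+-mono-≤ (ni zero i z≤n) (m∸n≤m m (toℕ i))) bd)
  distinct : ∀ j → toℕ j < toℕ i → column j ≢ column i
  distinct j j<i e = <-irrefl (sym e) (+-mono-≤-< (ni j i (<⇒≤ j<i)) (∸-monoʳ-< {m = m} j<i (≤-pred (toℕ<n i))))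
  at-column : maybe′ col ✚ (partCol lam (toℕ (fromℕ< column<))) ≡ col i
  at-column rewrite toℕ-fromℕ< column< | seek-hit column i distinct = refl

module VertexWeights {ℓ₁ ℓ₂} (R : CommutativeRing ℓ₁ ℓ₂) where
  open CommutativeRing R using (Carrier; _≈_; 0#; 1#; reflexive; *-cong; *-identityʳ; zeroʳ)
    renaming (refl to ≈-refl; sym to ≈-sym; trans to ≈-trans)
  open Weights R

  private variable
    x : Carrier

  wtC-zero-or-propagated : ∀ x (a b p q : CSpin r) → wtC x a b p q ≡ 0# ⊎
    (wtC x a b p q ≡ wtU x (forgetSpin a) (forgetSpin b) (forgetSpin p) (forgetSpin q) ×
     (p , q) ≡ propagate a b (forgetSpin p) (forgetSpin q))
  wtC-zero-or-propagated x ✚ ✚ ✚ ✚ = inj₂ (refl , refl)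
  wtC-zero-or-propagated x ✚ ✚ ✚ (col _) = inj₁ refl
  wtC-zero-or-propagated x ✚ ✚ (col _) ✚ = inj₁ refl
  wtC-zero-or-propagated x ✚ ✚ (col _) (col _) = inj₁ refl
  wtC-zero-or-propagated x ✚ (col _) ✚ ✚ = inj₁ refl
  wtC-zero-or-propagated x ✚ (col _) ✚ (col _) = inj₁ refl
  wtC-zero-or-propagated x ✚ (col j) (col k) ✚ with j ≟ k
  ... | yes refl = inj₂ (refl , refl)
  ... | no _ = inj₁ refl
  wtC-zero-or-propagated x ✚ (col _) (col _) (col _) = inj₁ refl
  wtC-zero-or-propagated x (col _) ✚ ✚ ✚ = inj₁ refl
  wtC-zero-or-propagated x (col i) ✚ ✚ (col k) with i ≟ k
  ... | yes refl = inj₂ (refl , refl)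
  ... | no _ = inj₁ refl
  wtC-zero-or-propagated x (col i) ✚ (col k) ✚ with i ≟ k
  ... | yes refl = inj₂ (refl , refl)
  ... | no _ = inj₁ refl
  wtC-zero-or-propagated x (col _) ✚ (col _) (col _) = inj₁ refl
  wtC-zero-or-propagated x (col _) (col _) ✚ ✚ = inj₁ refl
  wtC-zero-or-propagated x (col _) (col _) ✚ (col _) = inj₁ refl
  wtC-zero-or-propagated x (col _) (col _) (col _) ✚ = inj₁ refl
  wtC-zero-or-propagated x (col i) (col j) (col k) (col l) with k ≟ colMax i j
  ... | no _ = inj₁ refl
  ... | yes refl with l ≟ colMin i j
  ... | no _ = inj₁ refl
  ... | yes refl = inj₂ (refl , refl)

  wtC-nonzero : ∀ x (a b p q : CSpin r) → ¬ wtC x a b p q ≈ 0# →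
    wtC x a b p q ≡ wtU x (forgetSpin a) (forgetSpin b) (forgetSpin p) (forgetSpin q) ×
    (p , q) ≡ propagate a b (forgetSpin p) (forgetSpin q)
  wtC-nonzero x a b p q nz with wtC-zero-or-propagated x a b p q
  ... | inj₁ zero≡ = contradiction (reflexive zero≡) nz
  ... | inj₂ result = result

  private
    if-self : ∀ {a} {A : Set a} (i : Fin r) (y z : A) → (if does (i ≟ i) then y else z) ≡ y
    if-self i y z with i ≟ i
    ... | yes _ = refl
    ... | no i≢i = contradiction refl i≢i

  propagate-sound : ∀ x (a b : CSpin r) u v → ¬ wtU x (forgetSpin a) (forgetSpin b) u v ≈ 0# →
    forgetSpin (proj₁ (propagate a b u v)) ≡ u × forgetSpin (proj₂ (propagate a b u v)) ≡ v ×
    wtC x a b (proj₁ (propagate a b u v)) (proj₂ (propagate a b u v)) ≡ wtU x (forgetSpin a) (forgetSpin b) u v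
  propagate-sound x ✚ ✚ ⊕ ⊕ nz = refl , refl , refl
  propagate-sound x ✚ ✚ ⊕ ⊖ nz = contradiction ≈-refl nz
  propagate-sound x ✚ ✚ ⊖ ⊕ nz = contradiction ≈-refl nz
  propagate-sound x ✚ ✚ ⊖ ⊖ nz = contradiction ≈-refl nz
  propagate-sound x ✚ (col j) ⊕ ⊕ nz = contradiction ≈-refl nz
  propagate-sound x ✚ (col j) ⊕ ⊖ nz = contradiction ≈-refl nz
  propagate-sound x ✚ (col j) ⊖ ⊕ nz = refl , refl , if-self j 1# 0#
  propagate-sound x ✚ (col j) ⊖ ⊖ nz = contradiction ≈-refl nz
  propagate-sound x (col i) ✚ ⊕ ⊕ nz = contradiction ≈-refl nz
  propagate-sound x (col i) ✚ ⊕ ⊖ nz = refl , refl , if-self i x 0#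
  propagate-sound x (col i) ✚ ⊖ ⊕ nz = refl , refl , if-self i x 0#
  propagate-sound x (col i) ✚ ⊖ ⊖ nz = contradiction ≈-refl nz
  propagate-sound x (col i) (col j) ⊕ ⊕ nz = contradiction ≈-refl nz
  propagate-sound x (col i) (col j) ⊕ ⊖ nz = contradiction ≈-refl nz
  propagate-sound x (col i) (col j) ⊖ ⊕ nz = contradiction ≈-refl nz
  propagate-sound x (col i) (col j) ⊖ ⊖ nz = refl , refl , trans (if-self (colMax i j) _ 0#) (if-self (colMin i j) x 0#)

  wtU-values : ∀ x a b u v → wtU x a b u v ≡ 0# ⊎ wtU x a b u v ≡ x ⊎ wtU x a b u v ≡ 1#
  wtU-values x ⊕ ⊕ ⊕ ⊕ = inj₂ (inj₂ refl)
  wtU-values x ⊕ ⊕ ⊕ ⊖ = inj₁ refl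
  wtU-values x ⊕ ⊕ ⊖ ⊕ = inj₁ refl
  wtU-values x ⊕ ⊕ ⊖ ⊖ = inj₁ refl
  wtU-values x ⊕ ⊖ ⊕ ⊕ = inj₁ refl
  wtU-values x ⊕ ⊖ ⊕ ⊖ = inj₁ refl
  wtU-values x ⊕ ⊖ ⊖ ⊕ = inj₂ (inj₂ refl)
  wtU-values x ⊕ ⊖ ⊖ ⊖ = inj₁ refl
  wtU-values x ⊖ ⊕ ⊕ ⊕ = inj₁ refl
  wtU-values x ⊖ ⊕ ⊕ ⊖ = inj₂ (inj₁ refl)
  wtU-values x ⊖ ⊕ ⊖ ⊕ = inj₂ (inj₁ refl)
  wtU-values x ⊖ ⊕ ⊖ ⊖ = inj₁ refl
  wtU-values x ⊖ ⊖ ⊕ ⊕ = inj₁ refl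
  wtU-values x ⊖ ⊖ ⊕ ⊖ = inj₁ refl
  wtU-values x ⊖ ⊖ ⊖ ⊕ = inj₁ refl
  wtU-values x ⊖ ⊖ ⊖ ⊖ = inj₂ (inj₁ refl)

  1≉0 : ¬ x ≈ 0# → ¬ 1# ≈ 0#
  1≉0 {x} x≉0 1≈0 = x≉0 (≈-trans (≈-sym (*-identityʳ x)) (≈-trans (*-cong ≈-refl 1≈0) (zeroʳ x)))

  wtU≈0? : ¬ x ≈ 0# → ∀ a b u v → Dec (wtU x a b u v ≈ 0#)
  wtU≈0? {x} x≉0 a b u v with wtU-values x a b u v
  ... | inj₁ ≡0 = yes (reflexive ≡0)
  ... | inj₂ (inj₁ ≡x) = no (x≉0 ∘ ≈-trans (reflexive (sym ≡x)))
  ... | inj₂ (inj₂ ≡1) = no (1≉0 x≉0 ∘ ≈-trans (reflexive (sym ≡1)))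

  wtC≈0? : ¬ x ≈ 0# → ∀ (a b p q : CSpin r) → Dec (wtC x a b p q ≈ 0#)
  wtC≈0? {x} x≉0 a b p q with wtC-zero-or-propagated x a b p q
  ... | inj₁ ≡0 = yes (reflexive ≡0)
  ... | inj₂ (≡wtU , _) = map′ (≈-trans (reflexive ≡wtU)) (≈-trans (reflexive (sym ≡wtU)))
    (wtU≈0? x≉0 (forgetSpin a) (forgetSpin b) (forgetSpin p) (forgetSpin q))

  rowWtC : Carrier → Vec (CSpin r) (suc n) → Vec (CSpin r) n → Vec (CSpin r) n → Fin n → Carrier
  rowWtC x hs ts bs c = wtC x (lookup hs (suc c)) (lookup ts c) (lookup hs (inject₁ c)) (lookup bs c)

  rowWtU : Carrier → Vec USpin (suc n) → Vec USpin n → Vec USpin n → Fin n → Carrier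
  rowWtU x hs ts bs c = wtU x (lookup hs (suc c)) (lookup ts c) (lookup hs (inject₁ c)) (lookup bs c)

  gridWtC : ∀ {m N} → (Fin m → Carrier) → Config (CSpin r) m N → Fin m → Fin (suc N) → Carrier
  gridWtC z s k c = wtC (z k) (leftE s k c) (topE s k c) (rightE s k c) (botE s k c)

  ColoursRow : Carrier → Vec USpin (suc n) → Vec USpin n → Vec (CSpin r) n →
    Vec (CSpin r) (suc n) × Vec (CSpin r) n → Set ℓ₁
  ColoursRow x hU bU ts (hs , bs) = Vec.map forgetSpin hs ≡ hU × Vec.map forgetSpin bs ≡ bU ×
    (∀ c → rowWtC x hs ts bs c ≡ rowWtU x hU (Vec.map forgetSpin ts) bU c)

  ColoursGrid : ∀ {m N} → (Fin m → Carrier) → Config USpin m N → Config (CSpin r) m N → Set ℓ₁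
  ColoursGrid z (H , V) (Hc , Vc) = Vec.map (Vec.map forgetSpin) Hc ≡ H × Vec.map (Vec.map forgetSpin) Vc ≡ V ×
    (∀ k c → gridWtC z (Hc , Vc) k c ≡ vertexWtU z (H , V) k c)

  attachVertex-colours : ∀ x (t : CSpin r) u v (hs : Vec (CSpin r) (suc n)) bs {hU bU ts} →
    ColoursRow x hU bU ts (hs , bs) → ¬ wtU x (head hU) (forgetSpin t) u v ≈ 0# →
    ColoursRow x (u ∷ hU) (v ∷ bU) (t ∷ ts) (attachVertex t u v (hs , bs))
  attachVertex-colours x t u v (l ∷ hs) bs (refl , refl , row) nz = cong (_∷ _) fp , cong (_∷ _) fq , weights
    where
    vertex = propagate-sound x l t u v nz
    fp = proj₁ vertex
    fq = proj₁ (proj₂ vertex)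
    weights : ∀ c → _
    weights zero = proj₂ (proj₂ vertex)
    weights (suc c) = row c

  liftRow-colours : ∀ x (a : CSpin r) (hU : Vec USpin (suc n)) ts bU → forgetSpin a ≡ last hU →
    (∀ c → ¬ rowWtU x hU (Vec.map forgetSpin ts) bU c ≈ 0#) → ColoursRow x hU bU ts (liftRow a hU ts bU)
  liftRow-colours x a (u ∷ []) [] [] fa _ = cong (_∷ []) fa , refl , λ ()
  liftRow-colours x a (u ∷ hU@(_ ∷ _)) (t ∷ ts) (v ∷ bU) fa nz =
    attachVertex-colours x t u v (proj₁ rest) (proj₂ rest) (liftRow-colours x a hU ts bU fa (nz ∘ suc)) (nz zero)
    where rest = liftRow a hU ts bU

  liftRow-determined : ∀ x (hs : Vec (CSpin r) (suc n)) ts bs → (∀ c → ¬ rowWtC x hs ts bs c ≈ 0#) →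
    (hs , bs) ≡ liftRow (last hs) (Vec.map forgetSpin hs) ts (Vec.map forgetSpin bs)
  liftRow-determined x (_ ∷ []) [] [] _ = refl
  liftRow-determined x (p ∷ hs@(l ∷ _)) (t ∷ ts) (q ∷ bs) nz = begin
    (p ∷ hs , q ∷ bs)
      ≡⟨ cong (λ out → proj₁ out ∷ hs , proj₂ out ∷ bs) (proj₂ (wtC-nonzero x l t p q (nz zero))) ⟩
    attachVertex t (forgetSpin p) (forgetSpin q) (hs , bs)
      ≡⟨ cong (attachVertex t (forgetSpin p) (forgetSpin q)) (liftRow-determined x hs ts bs (nz ∘ suc)) ⟩
    liftRow (last hs) (Vec.map forgetSpin (p ∷ hs)) (t ∷ ts) (Vec.map forgetSpin (q ∷ bs)) ∎
    where open ≡-Reasoning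

  liftGrid-colours : ∀ {m N} (z : Fin m → Carrier) (T : Vec (CSpin r) (suc N)) (t : Config USpin m N) →
    Vec.map forgetSpin T ≡ head (proj₂ t) → Vec.map last (proj₁ t) ≡ replicate m ⊕ →
    (∀ k c → ¬ vertexWtU z t k c ≈ 0#) →
    ColoursGrid z t (liftGrid T t)
  liftGrid-colours z T ([] , _ ∷ []) refl _ _ = refl , refl , λ ()
  liftGrid-colours z T (h ∷ H , V₀ ∷ b ∷ V) refl lefts nz =
    cong₂ _∷_ (proj₁ row) (proj₁ rest) , cong (V₀ ∷_) (proj₁ (proj₂ rest)) , weights
    where
    row = liftRow-colours (z zero) ✚ h T b (sym (∷-injectiveˡ lefts)) (nz zero)
    rest = liftGrid-colours (z ∘ suc) (proj₂ (liftRow ✚ h T b)) (H , b ∷ V)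
      (proj₁ (proj₂ row)) (∷-injectiveʳ lefts) (nz ∘ suc)
    weights : ∀ k c → _
    weights zero = proj₂ (proj₂ row)
    weights (suc k) = proj₂ (proj₂ rest) k

  liftGrid-determined : ∀ {m N} (z : Fin m → Carrier)
    (H : Vec (Vec (CSpin r) (suc (suc N))) m) (V : Vec (Vec (CSpin r) (suc N)) (suc m)) →
    Vec.map last H ≡ replicate m ✚ → (∀ k c → ¬ gridWtC z (H , V) k c ≈ 0#) →
    (H , V) ≡ liftGrid (head V) (Vec.map (Vec.map forgetSpin) H , Vec.map (Vec.map forgetSpin) V)
  liftGrid-determined z [] (T ∷ []) _ _ = refl
  liftGrid-determined z (h ∷ H) (T ∷ b ∷ V) lefts nz =
    trans (cong (λ s → h ∷ proj₁ s , T ∷ proj₂ s) rest)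
          (cong (λ row → proj₁ row ∷ proj₁ (liftGrid (proj₂ row) t′) , T ∷ proj₂ (liftGrid (proj₂ row) t′)) row)
    where
    t′ = Vec.map (Vec.map forgetSpin) H , Vec.map forgetSpin b ∷ Vec.map (Vec.map forgetSpin) V
    row : (h , b) ≡ liftRow ✚ (Vec.map forgetSpin h) T (Vec.map forgetSpin b)
    row = subst (λ a → (h , b) ≡ liftRow a (Vec.map forgetSpin h) T (Vec.map forgetSpin b)) (∷-injectiveˡ lefts)
                (liftRow-determined (z zero) h T b (nz zero))
    rest = liftGrid-determined (z ∘ suc) H (b ∷ V) (∷-injectiveʳ lefts) (nz ∘ suc)

  vertexWtU-forget : ∀ {N} (z : Fin r → Carrier) (s : Config (CSpin r) r N) k c →
    vertexWtU z (forget s) k c ≡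
      wtU (z k) (forgetSpin (leftE s k c)) (forgetSpin (topE s k c)) (forgetSpin (rightE s k c)) (forgetSpin (botE s k c))
  vertexWtU-forget z (H , V) k c
    rewrite lookup-map² forgetSpin H k (suc c) | lookup-map² forgetSpin V (inject₁ k) c
          | lookup-map² forgetSpin H k (inject₁ c) | lookup-map² forgetSpin V (suc k) c = refl

  forget-vertexWt : ∀ {N} (z : Fin r → Carrier) (s : Config (CSpin r) r N) k c →
    ¬ vertexWtC z s k c ≈ 0# → vertexWtU z (forget s) k c ≡ vertexWtC z s k c
  forget-vertexWt z s k c nz = trans (vertexWtU-forget z s k c)
    (sym (proj₁ (wtC-nonzero (z k) (leftE s k c) (topE s k c) (rightE s k c) (botE s k c) nz)))

module FiniteSums {ℓ₁ ℓ₂} (R : CommutativeRing ℓ₁ ℓ₂) where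
  open CommutativeRing R
    using (Carrier; _≈_; 0#; setoid; +-commutativeSemigroup; +-cong; +-assoc; +-identityˡ; +-identityʳ; *-cong; zeroˡ; zeroʳ; reflexive)
    renaming (_+_ to _+ᴿ_; refl to ≈-refl; sym to ≈-sym; trans to ≈-trans)
  open Weights R using (sum; prod)
  open import Algebra.Properties.CommutativeSemigroup +-commutativeSemigroup using () renaming (interchange to +-interchange)
  open SetoidReasoning setoid

  private variable
    p q : Level

  sum-cong : (xs : List A) {g h : A → Carrier} → (∀ x → g x ≈ h x) → sum (map g xs) ≈ sum (map h xs)
  sum-cong [] _ = ≈-refl
  sum-cong (x ∷ xs) g≈h = +-cong (g≈h x) (sum-cong xs g≈h)

  sum-zero : (xs : List A) {g : A → Carrier} → (∀ x → g x ≈ 0#) → sum (map g xs) ≈ 0#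
  sum-zero [] _ = ≈-refl
  sum-zero (x ∷ xs) g≈0 = ≈-trans (+-cong (g≈0 x) (sum-zero xs g≈0)) (+-identityˡ 0#)

  sum-++ : (g : A → Carrier) (xs ys : List A) → sum (map g (xs ++ ys)) ≈ sum (map g xs) +ᴿ sum (map g ys)
  sum-++ g [] ys = ≈-sym (+-identityˡ _)
  sum-++ g (x ∷ xs) ys = ≈-trans (+-cong ≈-refl (sum-++ g xs ys)) (≈-sym (+-assoc _ _ _))

  sum-map : (g : B → Carrier) (h : A → B) (xs : List A) → sum (map g (map h xs)) ≡ sum (map (g ∘ h) xs)
  sum-map g h xs = cong sum (sym (ListP.map-∘ xs))

  sum-+ : (g h : A → Carrier) (xs : List A) → sum (map (λ x → g x +ᴿ h x) xs) ≈ sum (map g xs) +ᴿ sum (map h xs)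
  sum-+ g h [] = ≈-sym (+-identityˡ 0#)
  sum-+ g h (x ∷ xs) = ≈-trans (+-cong ≈-refl (sum-+ g h xs)) (+-interchange (g x) (h x) _ _)

  sum-swap : (g : A → B → Carrier) (xs : List A) (ys : List B) →
    sum (map (λ x → sum (map (g x) ys)) xs) ≈ sum (map (λ y → sum (map (λ x → g x y) xs)) ys)
  sum-swap g [] ys = ≈-sym (sum-zero ys (λ _ → ≈-refl))
  sum-swap g (x ∷ xs) ys = ≈-trans (+-cong ≈-refl (sum-swap g xs ys)) (≈-sym (sum-+ (g x) _ ys))

  sum-concatMap : (g : B → Carrier) (F : A → List B) (xs : List A) →
    sum (map g (concatMap F xs)) ≈ sum (map (λ x → sum (map g (F x))) xs)
  sum-concatMap g F [] = ≈-refl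
  sum-concatMap g F (x ∷ xs) = ≈-trans (sum-++ g (F x) (concatMap F xs)) (+-cong ≈-refl (sum-concatMap g F xs))

  sum-cartesianProduct : (g : A × B → Carrier) (xs : List A) (ys : List B) →
    sum (map g (cartesianProduct xs ys)) ≈ sum (map (λ x → sum (map (λ y → g (x , y)) ys)) xs)
  sum-cartesianProduct g [] ys = ≈-refl
  sum-cartesianProduct g (x ∷ xs) ys = ≈-trans (sum-++ g (map (x ,_) ys) (cartesianProduct xs ys))
    (+-cong (reflexive (sum-map g (x ,_) ys)) (sum-cartesianProduct g xs ys))

  _when_ : {P : Set p} → Carrier → Dec P → Carrier
  x when d = if does d then x else 0#

  when-yes : {P : Set p} (d : Dec P) {x : Carrier} → P → (x when d) ≡ x
  when-yes (yes _) _ = refl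
  when-yes (no ¬P) P = contradiction P ¬P

  when-vanishes : {P : Set p} (d : Dec P) {x : Carrier} → (P → x ≈ 0#) → (x when d) ≈ 0#
  when-vanishes (yes P) x≈0 = x≈0 P
  when-vanishes (no _) _ = ≈-refl

  when-cong : {P : Set p} (d : Dec P) {x y : Carrier} → x ≈ y → (x when d) ≈ (y when d)
  when-cong (yes _) x≈y = x≈y
  when-cong (no _) _ = ≈-refl

  sum-when : {P : Set p} (d : Dec P) (g : A → Carrier) (xs : List A) →
    (sum (map g xs) when d) ≈ sum (map (λ x → g x when d) xs)
  sum-when (yes _) g xs = ≈-refl
  sum-when (no _) g xs = ≈-sym (sum-zero xs (λ _ → ≈-refl))

  sum-filter : {P : Pred A p} (P? : Decidable P) (g : A → Carrier) (xs : List A) →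
    sum (map g (filter P? xs)) ≈ sum (map (λ x → g x when P? x) xs)
  sum-filter P? g [] = ≈-refl
  sum-filter P? g (x ∷ xs) with does (P? x)
  ... | true = +-cong ≈-refl (sum-filter P? g xs)
  ... | false = ≈-trans (sum-filter P? g xs) (≈-sym (+-identityˡ _))

  -- y occurs exactly once in xs, phrased in the form in which it is used for sums.
  Sifts : List A → A → Set _
  Sifts xs y = ∀ g → (∀ x → x ≢ y → g x ≈ 0#) → sum (map g xs) ≈ g y

  Enumerates : List A → Set _
  Enumerates xs = ∀ y → Sifts xs y

  sum-allFin-suc : ∀ {n} (g : Fin (suc n) → Carrier) → sum (map g (allFin (suc n))) ≡ g zero +ᴿ sum (map (g ∘ suc) (allFin n))
  sum-allFin-suc g = cong (λ l → g zero +ᴿ sum l) (trans (ListP.map-tabulate suc g) (sym (ListP.map-tabulate id (g ∘ suc))))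

  allFin-enumerates : ∀ {n} → Enumerates (allFin n)
  allFin-enumerates {suc n} zero g g≈0 = ≈-trans (reflexive (sum-allFin-suc g))
    (≈-trans (+-cong ≈-refl (sum-zero (allFin n) λ j → g≈0 (suc j) λ ())) (+-identityʳ _))
  allFin-enumerates {suc n} (suc i) g g≈0 = ≈-trans (reflexive (sum-allFin-suc g))
    (≈-trans (+-cong (g≈0 zero λ ()) (allFin-enumerates i (g ∘ suc) λ j j≢i → g≈0 (suc j) (j≢i ∘ suc-injective)))
             (+-identityˡ _))

  allUSpin-enumerates : Enumerates allUSpin
  allUSpin-enumerates ⊕ g g≈0 = ≈-trans (+-cong ≈-refl (≈-trans (+-identityʳ _) (g≈0 ⊖ λ ()))) (+-identityʳ _)
  allUSpin-enumerates ⊖ g g≈0 = ≈-trans (+-cong (g≈0 ⊕ λ ()) (+-identityʳ _)) (+-identityˡ _)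

  allCSpin-enumerates : ∀ {r} → Enumerates (allCSpin r)
  allCSpin-enumerates {r} ✚ g g≈0 = ≈-trans (+-cong ≈-refl (≈-trans (reflexive (sum-map g col (allFin r)))
    (sum-zero (allFin r) λ i → g≈0 (col i) λ ()))) (+-identityʳ _)
  allCSpin-enumerates {r} (col i) g g≈0 = ≈-trans (+-cong (g≈0 ✚ λ ()) (≈-trans (reflexive (sum-map g col (allFin r)))
    (allFin-enumerates i (g ∘ col) λ j j≢i → g≈0 (col j) (j≢i ∘ col-injective)))) (+-identityˡ _)

  sum²-sifts : (f : A → B → C) → (∀ {x x′ y y′} → f x y ≡ f x′ y′ → x ≡ x′ × y ≡ y′) →
    (xs : List A) (ys : List B) →
    Enumerates xs → Enumerates ys → ∀ x₀ y₀ g → (∀ w → w ≢ f x₀ y₀ → g w ≈ 0#) →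
    sum (map (λ x → sum (map (λ y → g (f x y)) ys)) xs) ≈ g (f x₀ y₀)
  sum²-sifts f f-injective xs ys xs-enum ys-enum x₀ y₀ g g≈0 =
    ≈-trans (xs-enum x₀ _ λ x x≢x₀ → sum-zero ys λ y → g≈0 (f x y) (x≢x₀ ∘ proj₁ ∘ f-injective))
            (ys-enum y₀ (g ∘ f x₀) λ y y≢y₀ → g≈0 (f x₀ y) (y≢y₀ ∘ proj₂ ∘ f-injective))

  vecs-enumerates : {A : Set} (xs : List A) → Enumerates xs → ∀ n → Enumerates (vecs xs n)
  vecs-enumerates xs xs-enum ℕ.zero [] g _ = +-identityʳ _
  vecs-enumerates xs xs-enum (suc n) (x ∷ v) g g≈0 =
    ≈-trans (sum-concatMap g (λ x → map (x ∷_) (vecs xs n)) xs)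
    (≈-trans (sum-cong xs λ x → reflexive (sum-map g (x ∷_) (vecs xs n)))
             (sum²-sifts _∷_ ∷-injective xs (vecs xs n) xs-enum (vecs-enumerates xs xs-enum n) x v g g≈0))

  cartesianProduct-enumerates : (xs : List A) (ys : List B) → Enumerates xs → Enumerates ys → Enumerates (cartesianProduct xs ys)
  cartesianProduct-enumerates xs ys xs-enum ys-enum (x , y) g g≈0 =
    ≈-trans (sum-cartesianProduct g xs ys)
            (sum²-sifts _,_ (λ e → ,-injectiveˡ e , ,-injectiveʳ e) xs ys xs-enum ys-enum x y g g≈0)

  allConfigs-enumerates : {A : Set} (xs : List A) → Enumerates xs → ∀ r N → Enumerates (allConfigs xs r N)
  allConfigs-enumerates xs xs-enum r N = cartesianProduct-enumerates (vecs rows r) (vecs columns (suc r))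
    (vecs-enumerates rows (vecs-enumerates xs xs-enum (suc (suc N))) r)
    (vecs-enumerates columns (vecs-enumerates xs xs-enum (suc N)) (suc r))
    where
    rows = vecs xs (suc (suc N))
    columns = vecs xs (suc N)

  -- Change of variables along φ, which restricts to a bijection from the support Q of G onto the support P of F.
  module _ {A B : Set} {P : Pred A p} {Q : Pred B q} (_≟_ : DecidableEquality A)
    (xs : List A) (ys : List B) (xs-enum : Enumerates xs) (ys-enum : Enumerates ys)
    (P? : Decidable P) (φ : B → A) (F : A → Carrier) (G : B → Carrier)
    (F-vanishes : ∀ x → ¬ P x → F x ≈ 0#) (G-vanishes : ∀ y → ¬ Q y → G y ≈ 0#)
    (φ-into : ∀ {y} → Q y → P (φ y)) (φ-injective : ∀ {y y′} → Q y → Q y′ → φ y ≡ φ y′ → y ≡ y′)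
    (φ-onto : ∀ {x} → P x → ∃[ y ] Q y × φ y ≡ x) (φ-weight : ∀ {y} → Q y → F (φ y) ≈ G y) where

    fibre-sum : ∀ x → F x ≈ sum (map (λ y → G y when (φ y ≟ x)) ys)
    fibre-sum x with P? x
    ... | no ¬Px = ≈-trans (F-vanishes x ¬Px) (≈-sym (sum-zero ys λ y → when-vanishes (φ y ≟ x)
            λ φy≡x → G-vanishes y λ Qy → ¬Px (subst P φy≡x (φ-into Qy))))
    ... | yes Px with φ-onto Px
    ... | y₀ , Qy₀ , refl = ≈-sym (begin
      sum (map (λ y → G y when (φ y ≟ φ y₀)) ys) ≈⟨ ys-enum y₀ _ off-y₀ ⟩
      (G y₀ when (φ y₀ ≟ φ y₀))                  ≡⟨ when-yes (φ y₀ ≟ φ y₀) refl ⟩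
      G y₀                                       ≈⟨ ≈-sym (φ-weight Qy₀) ⟩
      F (φ y₀)                                   ∎)
      where
      off-y₀ : ∀ y → y ≢ y₀ → (G y when (φ y ≟ φ y₀)) ≈ 0#
      off-y₀ y y≢y₀ = when-vanishes (φ y ≟ φ y₀) λ e → G-vanishes y λ Qy → y≢y₀ (φ-injective Qy Qy₀ e)

    sum-reindex : sum (map F xs) ≈ sum (map G ys)
    sum-reindex = begin
      sum (map F xs)
        ≈⟨ sum-cong xs fibre-sum ⟩
      sum (map (λ x → sum (map (λ y → G y when (φ y ≟ x)) ys)) xs)
        ≈⟨ sum-swap (λ x y → G y when (φ y ≟ x)) xs ys ⟩
      sum (map (λ y → sum (map (λ x → G y when (φ y ≟ x)) xs)) ys)
        ≈⟨ sum-cong ys sifted ⟩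
      sum (map G ys) ∎
      where
      sifted : ∀ y → sum (map (λ x → G y when (φ y ≟ x)) xs) ≈ G y
      sifted y = ≈-trans (xs-enum (φ y) _ λ x x≢φy → when-vanishes (φ y ≟ x) λ e → contradiction (sym e) x≢φy)
                         (reflexive (when-yes (φ y ≟ φ y) refl))

  prod-zero : {xs : List A} {x : A} (g : A → Carrier) → x ∈ₗ xs → g x ≈ 0# → prod (map g xs) ≈ 0#
  prod-zero g (ListAny.here refl) gx≈0 = ≈-trans (*-cong gx≈0 ≈-refl) (zeroˡ _)
  prod-zero g (ListAny.there x∈xs) gx≈0 = ≈-trans (*-cong ≈-refl (prod-zero g x∈xs gx≈0)) (zeroʳ _)

  gridProd : ∀ {m n} → (Fin m → Fin n → Carrier) → Carrier
  gridProd {m} {n} W = prod (map (λ k → prod (map (W k) (allFin n))) (allFin m))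

  gridProd-vanishes : ∀ {m n} (W : Fin m → Fin n → Carrier) → (∀ k c → Dec (W k c ≈ 0#)) →
    ¬ (∀ k c → ¬ W k c ≈ 0#) → gridProd W ≈ 0#
  gridProd-vanishes {m} {n} W W≈0? not-all-nonzero =
    prod-zero _ (∈-allFin k) (prod-zero (W k) (∈-allFin c) (decidable-stable (W≈0? k c) W≉0))
    where
    bad-row = ¬∀⟶∃¬ m _ (λ k → all? λ c → ¬? (W≈0? k c)) not-all-nonzero
    k = proj₁ bad-row
    bad-vertex = ¬∀⟶∃¬ n _ (λ c → ¬? (W≈0? k c)) (proj₂ bad-row)
    c = proj₁ bad-vertex
    W≉0 = proj₂ bad-vertex

  gridProd-cong : ∀ {m n} {W W′ : Fin m → Fin n → Carrier} → (∀ k c → W k c ≡ W′ k c) → gridProd W ≡ gridProd W′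
  gridProd-cong {m} {n} W≡W′ = cong prod (ListP.map-cong (λ k → cong prod (ListP.map-cong (W≡W′ k) (allFin n))) (allFin m))

module Proposition {ℓ₁ ℓ₂} (R : CommutativeRing ℓ₁ ℓ₂) (m : ℕ) (lam : Vec ℕ (suc m)) (ni : Nonincreasing lam)
  (N : ℕ) (bd : head lam + m ≤ N) (z : Fin (suc m) → CommutativeRing.Carrier R)
  (z≉0 : ∀ k → ¬ CommutativeRing._≈_ R (z k) (CommutativeRing.0# R)) where

  open CommutativeRing R using (Carrier; _≈_; 0#; reflexive; setoid) renaming (sym to ≈-sym; trans to ≈-trans)
  open Weights R
  open VertexWeights R
  open FiniteSums R

  Perm = Vec (Fin (suc m)) (suc m)
  Uncoloured = Config USpin (suc m) N
  Coloured = Config (CSpin (suc m)) (suc m) N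

  forget-boundary : ∀ {w} (s : Coloured) → IsPerm w → BdryC lam w s → BdryU lam (forget s)
  forget-boundary {w} (H , V₀ ∷ V) w-perm (top , left , bottom , right) =
    trans (cong (Vec.map forgetSpin) top) (topC-forget N lam) ,
    trans (map-last-map forgetSpin H) (trans (cong (Vec.map forgetSpin) left) (map-replicate forgetSpin ✚ (suc m))) ,
    trans (last-map (Vec.map forgetSpin) (V₀ ∷ V)) (trans (cong (Vec.map forgetSpin) bottom) (map-replicate forgetSpin ✚ (suc N))) ,
    trans (map-head-map forgetSpin H) (≡-replicate right-⊖)
    where
    right-⊖ : ∀ k → lookup (Vec.map forgetSpin (Vec.map head H)) k ≡ ⊖
    right-⊖ k with isPerm-surjective w-perm k
    ... | i , refl = trans (lookup-map (lookup w i) forgetSpin (Vec.map head H))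
                       (cong forgetSpin (trans (lookup-map (lookup w i) head H) (right i)))

  forget-admissible : ∀ (w : Perm) (s : Coloured) → IsPerm w → AdmC z lam w s → AdmU z lam (forget s)
  forget-admissible w s w-perm (bdry , nz) =
    forget-boundary s w-perm bdry , λ k c → subst (λ x → ¬ x ≈ 0#) (sym (forget-vertexWt z s k c (nz k c))) (nz k c)

  forget-preserves-weight : ∀ (w : Perm) (s : Coloured) → IsPerm w → AdmC z lam w s → boltzU z (forget s) ≡ boltzC z s
  forget-preserves-weight w s _ (_ , nz) = gridProd-cong λ k c → forget-vertexWt z s k c (nz k c)

  admissible-determined : ∀ w (s : Coloured) → AdmC z lam w s → s ≡ liftGrid (topC N lam) (forget s)
  admissible-determined w (H , V) ((top , left , _ , _) , nz) =
    trans (liftGrid-determined z H V left nz) (cong (λ T → liftGrid T (forget (H , V))) top)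

  forget-injective : ∀ (w₁ w₂ : Perm) (s₁ s₂ : Coloured) → IsPerm w₁ → IsPerm w₂ →
    AdmC z lam w₁ s₁ → AdmC z lam w₂ s₂ → forget s₁ ≡ forget s₂ → (w₁ ≡ w₂) × (s₁ ≡ s₂)
  forget-injective w₁ w₂ s₁ s₂ _ w₂-perm adm₁@((_ , _ , _ , right₁) , _) adm₂@((_ , _ , _ , right₂) , _) e =
    labels-determine-perm (head ∘ lookup (proj₁ s₂)) col col-injective w₁ w₂ w₂-perm right₁′ right₂ , s₁≡s₂
    where
    s₁≡s₂ : s₁ ≡ s₂
    s₁≡s₂ = trans (admissible-determined w₁ s₁ adm₁)
                  (trans (cong (liftGrid (topC N lam)) e) (sym (admissible-determined w₂ s₂ adm₂)))
    right₁′ : ∀ i → head (lookup (proj₁ s₂) (lookup w₁ i)) ≡ col i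
    right₁′ = subst (λ s → ∀ i → head (lookup (proj₁ s) (lookup w₁ i)) ≡ col i) s₁≡s₂ right₁

  forget-surjective : ∀ (t : Uncoloured) → AdmU z lam t →
    Σ[ w ∈ Perm ] Σ[ s ∈ Coloured ] (IsPerm w × AdmC z lam w s × (forget s ≡ t))
  forget-surjective t@(H , V₀ ∷ V) ((top , left , bottom , _) , nz) =
    w , s , w-perm , (bdryC , nzC) , cong₂ _,_ forget-H forget-V
    where
    s = liftGrid (topC N lam) t
    coloured = liftGrid-colours z (topC N lam) t (trans (topC-forget N lam) (sym top)) left nz
    forget-H = proj₁ coloured
    forget-V = proj₁ (proj₂ coloured)
    left✚ : Vec.map last (proj₁ s) ≡ replicate (suc m) ✚
    left✚ = map-forgetSpin⁻¹-⊕ _ (trans (sym (map-last-map forgetSpin (proj₁ s))) (trans (cong (Vec.map last) forget-H) left))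
    bottom✚ : last (proj₂ s) ≡ replicate (suc N) ✚
    bottom✚ = map-forgetSpin⁻¹-⊕ _ (trans (sym (last-map (Vec.map forgetSpin) (proj₂ s))) (trans (cong last forget-V) bottom))
    exit : ∀ i → ∃[ k ] head (lookup (proj₁ s) k) ≡ col i
    exit i = colour-exits-right (topC N lam) t bottom✚ (topC-contains lam ni bd i)
    w = tabulate (proj₁ ∘ exit)
    right : ∀ i → head (lookup (proj₁ s) (lookup w i)) ≡ col i
    right i = subst (λ k → head (lookup (proj₁ s) k) ≡ col i) (sym (lookup∘tabulate (proj₁ ∘ exit) i)) (proj₂ (exit i))
    w-perm = tabulate-isPerm λ {i} {j} e →
      col-injective (trans (sym (proj₂ (exit i))) (trans (cong (head ∘ lookup (proj₁ s)) e) (proj₂ (exit j))))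
    bdryC : BdryC lam w s
    bdryC = refl , left✚ , bottom✚ , right
    nzC : ∀ k c → ¬ vertexWtC z s k c ≈ 0#
    nzC k c = subst (λ x → ¬ x ≈ 0#) (sym (proj₂ (proj₂ coloured) k c)) (nz k c)

  vertexWtU≈0? : ∀ (t : Uncoloured) k c → Dec (vertexWtU z t k c ≈ 0#)
  vertexWtU≈0? t k c = wtU≈0? (z≉0 k) (leftE t k c) (topE t k c) (rightE t k c) (botE t k c)

  vertexWtC≈0? : ∀ (s : Coloured) k c → Dec (vertexWtC z s k c ≈ 0#)
  vertexWtC≈0? s k c = wtC≈0? (z≉0 k) (leftE s k c) (topE s k c) (rightE s k c) (botE s k c)

  admU? : ∀ (t : Uncoloured) → Dec (AdmU z lam t)
  admU? t = bdryU? lam t ×-dec all? λ k → all? λ c → ¬? (vertexWtU≈0? t k c)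

  AdmColoured : Pred (Perm × Coloured) ℓ₂
  AdmColoured (w , s) = IsPerm w × AdmC z lam w s

  uncolouredTerm : Uncoloured → Carrier
  uncolouredTerm t = boltzU z t when bdryU? lam t

  colouredTerm : Perm × Coloured → Carrier
  colouredTerm (w , s) = (boltzC z s when bdryC? lam w s) when isPerm? w

  forget-term : ∀ w s → AdmColoured (w , s) → uncolouredTerm (forget s) ≡ colouredTerm (w , s)
  forget-term w s (w-perm , adm) = begin
    uncolouredTerm (forget s)        ≡⟨ when-yes (bdryU? lam (forget s)) (proj₁ (forget-admissible w s w-perm adm)) ⟩
    boltzU z (forget s)              ≡⟨ forget-preserves-weight w s w-perm adm ⟩
    boltzC z s                       ≡⟨ sym (when-yes (bdryC? lam w s) (proj₁ adm)) ⟩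
    (boltzC z s when bdryC? lam w s) ≡⟨ sym (when-yes (isPerm? w) w-perm) ⟩
    colouredTerm (w , s)             ∎
    where open ≡-Reasoning

  perms = vecs (allFin (suc m)) (suc m)
  uncolouredStates = allConfigs allUSpin (suc m) N
  colouredStates = allConfigs (allCSpin (suc m)) (suc m) N

  uncoloured-sum≈coloured-sum :
    sum (map uncolouredTerm uncolouredStates) ≈ sum (map colouredTerm (cartesianProduct perms colouredStates))
  uncoloured-sum≈coloured-sum = sum-reindex
    (≡-dec (VecP.≡-dec (VecP.≡-dec _≟U_)) (VecP.≡-dec (VecP.≡-dec _≟U_)))
    uncolouredStates (cartesianProduct perms colouredStates)
    (allConfigs-enumerates allUSpin allUSpin-enumerates (suc m) N)
    (cartesianProduct-enumerates perms colouredStates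
      (vecs-enumerates (allFin (suc m)) allFin-enumerates (suc m))
      (allConfigs-enumerates (allCSpin (suc m)) allCSpin-enumerates (suc m) N))
    admU? (forget ∘ proj₂) uncolouredTerm colouredTerm
    (λ t ¬adm → when-vanishes (bdryU? lam t) λ b →
       gridProd-vanishes (vertexWtU z t) (vertexWtU≈0? t) λ nz → ¬adm (b , nz))
    (λ (w , s) ¬adm → when-vanishes (isPerm? w) λ w-perm → when-vanishes (bdryC? lam w s) λ b →
       gridProd-vanishes (vertexWtC z s) (vertexWtC≈0? s) λ nz → ¬adm (w-perm , b , nz))
    (λ {(w , s)} (w-perm , adm) → forget-admissible w s w-perm adm)
    (λ {(w₁ , s₁)} {(w₂ , s₂)} (w₁-perm , adm₁) (w₂-perm , adm₂) e →
       let (w₁≡w₂ , s₁≡s₂) = forget-injective w₁ w₂ s₁ s₂ w₁-perm w₂-perm adm₁ adm₂ e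
       in cong₂ _,_ w₁≡w₂ s₁≡s₂)
    (λ {t} adm → let (w , s , w-perm , admC , e) = forget-surjective t adm in (w , s) , (w-perm , admC) , e)
    (λ {(w , s)} adm → reflexive (forget-term w s adm))

  partition-functions : ZU (suc m) N z lam ≈ sum (map (ZC (suc m) N z lam) (allPerms (suc m)))
  partition-functions = begin
    ZU (suc m) N z lam
      ≈⟨ sum-filter (bdryU? lam) (boltzU z) uncolouredStates ⟩
    sum (map uncolouredTerm uncolouredStates)
      ≈⟨ uncoloured-sum≈coloured-sum ⟩
    sum (map colouredTerm (cartesianProduct perms colouredStates))
      ≈⟨ sum-cartesianProduct colouredTerm perms colouredStates ⟩
    sum (map (λ w → sum (map (λ s → colouredTerm (w , s)) colouredStates)) perms)
      ≈⟨ sum-cong perms (≈-sym ∘ ZC-when-perm) ⟩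
    sum (map (λ w → ZC (suc m) N z lam w when isPerm? w) perms)
      ≈⟨ ≈-sym (sum-filter isPerm? (ZC (suc m) N z lam) perms) ⟩
    sum (map (ZC (suc m) N z lam) (allPerms (suc m))) ∎
    where
    open SetoidReasoning setoid
    ZC-when-perm : ∀ w → (ZC (suc m) N z lam w when isPerm? w) ≈ sum (map (λ s → colouredTerm (w , s)) colouredStates)
    ZC-when-perm w = ≈-trans (when-cong (isPerm? w) (sum-filter (bdryC? lam w) (boltzC z) colouredStates))
                             (sum-when (isPerm? w) _ colouredStates)

proposition4p1 : {c ℓ : Level} (R : CommutativeRing c ℓ) →
    let open Weights R in
    (m : ℕ) → let r = suc m in
    (lam : Vec ℕ r) → Nonincreasing lam →
    (N : ℕ) → head lam + m ≤ N →
    (z : Fin r → CommutativeRing.Carrier R) → (∀ k → ¬ (CommutativeRing._≈_ R (z k) (CommutativeRing.0# R))) →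
    -- forgetting colors sends admissible colored states to admissible uncolored states
    (∀ (w : Vec (Fin r) r) (s : Config (CSpin r) r N) → IsPerm w → AdmC z lam w s → AdmU z lam (forget s))
    -- injective on the disjoint union over w ∈ S_r
    × (∀ (w₁ w₂ : Vec (Fin r) r) (s₁ s₂ : Config (CSpin r) r N) → IsPerm w₁ → IsPerm w₂ →
         AdmC z lam w₁ s₁ → AdmC z lam w₂ s₂ → forget s₁ ≡ forget s₂ → (w₁ ≡ w₂) × (s₁ ≡ s₂))
    -- surjective onto admissible uncolored states
    × (∀ (t : Config USpin r N) → AdmU z lam t →
         Σ[ w ∈ Vec (Fin r) r ] Σ[ s ∈ Config (CSpin r) r N ] (IsPerm w × AdmC z lam w s × (forget s ≡ t)))
    -- preserves Boltzmann weights
    × (∀ (w : Vec (Fin r) r) (s : Config (CSpin r) r N) → IsPerm w → AdmC z lam w s → CommutativeRing._≈_ R (boltzU z (forget s)) (boltzC z s))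
    -- hence Z(S_{z,λ}) = Σ_{w ∈ S_r} Z(S_{z,λ,w})
    × CommutativeRing._≈_ R (ZU r N z lam) (sum (map (ZC r N z lam) (allPerms r)))
proposition4p1 R m lam ni N bd z z≉0 =
  forget-admissible , forget-injective , forget-surjective ,
  (λ w s w-perm adm → CommutativeRing.reflexive R (forget-preserves-weight w s w-perm adm)) ,
  partition-functions
  where open Proposition R m lam ni N bd z z≉0
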